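{- The complete bipartite graph $K_{2,3}$ is $2$-monophilic.
   Context: A $2$-list assignment for a graph $G$ assigns to each vertex $v$ a set $L(v)\subseteq\mathbb{N}$ with $|L(v)|=2$. A coloring of $G$ from $L$ is a map $\gamma$ with $\gamma(v)\in L(v)$ and $\gamma(v)\neq\gamma(w)$ for adjacent $v,w$; $\mathrm{col}(G,L)$ is the number of such colorings, and $\mathrm{col}(G,2)$ is $\mathrm{col}(G,L)$ for $L(v)=\{1,2\}$ for all $v$. $G$ is $2$-monophilic if $\mathrm{col}(G,2)\le\mathrm{col}(G,L)$ for every $2$-list assignment $L$. -}

module Defs where

open import Data.Nat using (ℕ; zero; suc; _+_; _≤_)
open import Data.Bool using (Bool; true; false; if_then_else_)
open import Data.Fin using (Fin; zero; suc)
open import Data.Product using (_×_; _,_; proj₁; proj₂)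
open import Data.List using (List; []; _∷_; map; _++_; length; filter)
open import Relation.Binary.PropositionalEquality using (_≡_)
open import Relation.Nullary using (¬_; Dec; yes; no)
open import Relation.Nullary.Decidable using (¬?; _×-dec_)
open import Data.Nat.Properties using (_≟_)
open import Data.List.Relation.Unary.All using (All)
open import Data.List.Relation.Unary.All using (all?)

-- A finite simple graph on vertex set Fin n, given by its list of edges.
-- (Loopless; multiplicity of edges does not affect colourings.)
record Graph (n : ℕ) : Set where
  field
    edges : List (Fin n × Fin n)
open Graph public

-- A 2-list assignment: each vertex v gets a set L(v) = {a, b} ⊆ ℕ with a ≠ b,
-- represented as an ordered pair with distinct entries.
record ListAssignment2 (n : ℕ) : Set where
  field
    lists    : Fin n → ℕ × ℕ
    distinct : ∀ v → ¬ (proj₁ (lists v) ≡ proj₂ (lists v))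
open ListAssignment2 public

-- All functions Fin n → Bool, as a list (each appears exactly once).
allChoices : (n : ℕ) → List (Fin n → Bool)
allChoices zero    = (λ ()) ∷ []
allChoices (suc n) =
  map (λ f → λ { zero → false ; (suc i) → f i }) (allChoices n) ++
  map (λ f → λ { zero → true  ; (suc i) → f i }) (allChoices n)

-- A map γ with γ(v) ∈ L(v) corresponds exactly to choosing, for each v,
-- one of the two (distinct) elements of L(v).
pick : ℕ × ℕ → Bool → ℕ
pick (a , b) false = a
pick (a , b) true  = b

colourOf : ∀ {n} → (Fin n → ℕ × ℕ) → (Fin n → Bool) → Fin n → ℕ
colourOf L c v = pick (L v) (c v)

Proper : ∀ {n} → Graph n → (Fin n → ℕ) → Set
Proper G γ = All (λ e → ¬ (γ (proj₁ e) ≡ γ (proj₂ e))) (edges G)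

proper? : ∀ {n} (G : Graph n) (γ : Fin n → ℕ) → Dec (Proper G γ)
proper? G γ = all? (λ e → ¬? (γ (proj₁ e) ≟ γ (proj₂ e))) (edges G)

colL : ∀ {n} → Graph n → (Fin n → ℕ × ℕ) → ℕ
colL {n} G L = length (filter (λ c → proper? G (colourOf L c)) (allChoices n))

col : ∀ {n} → Graph n → ListAssignment2 n → ℕ
col G L = colL G (lists L)

col2 : ∀ {n} → Graph n → ℕ
col2 G = colL G (λ _ → (1 , 2))

TwoMonophilic : ∀ {n} → Graph n → Set
TwoMonophilic {n} G = (L : ListAssignment2 n) → col2 G ≤ col G L

K23 : Graph 5
K23 = record { edges =
  (v0 , v2) ∷ (v0 , v3) ∷ (v0 , v4) ∷ (v1 , v2) ∷ (v1 , v3) ∷ (v1 , v4) ∷ [] }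
  where
  v0 v1 v2 v3 v4 : Fin 5
  v0 = zero
  v1 = suc zero
  v2 = suc (suc zero)
  v3 = suc (suc (suc zero))
  v4 = suc (suc (suc (suc zero)))

-- Colour the part {0, 1} first, say with the pair of colours X = (x , y), where x ∈ L(0) and
-- y ∈ L(1); a vertex v of the part of size three can then be coloured unless L(v) ⊆ X, in which
-- case X blocks v. Suppose X extends to a colouring and the complementary pair X′ (the other
-- colours of L(0) and L(1)) is disjoint from X. Either X′ also extends, giving a second
-- colouring that differs at vertex 0, or X′ blocks some v; then L(v) = X′ avoids X, so v can be
-- recoloured in the first colouring. If x = y for some choice, X blocks nothing and its
-- complement avoids X. Otherwise L(0) and L(1) are disjoint, X and X′ are always disjoint, and
-- each v is blocked by at most one of the four choices, so by pigeonhole some choice extends.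
-- Hence col(K₂,₃, L) ≥ 2 = col(K₂,₃, 2).
module Submission where

open import Defs
open import Data.Bool using (Bool; true; false; not)
open import Data.Bool.Properties using (not-¬)
open import Data.Empty using (⊥-elim)
open import Data.Fin using (Fin; zero; suc)
import Data.Fin.Properties as Fin
open import Data.List using ([]; _∷_; filter; length)
open import Data.List.Properties using (filter-some)
open import Data.List.Relation.Unary.All as All using (_∷_; [])
open import Data.List.Relation.Unary.Any as Any using (Any; here; there)
open import Data.List.Relation.Unary.Any.Properties using (map⁺; ++⁺ˡ; ++⁺ʳ)
open import Data.Nat using (ℕ; zero; suc; _≤_; s≤s)
open import Data.Nat.Properties using (_≟_; m≤n⇒m≤1+n; n<1+n)
open import Data.Product using (_×_; _,_; proj₁; proj₂; ∃)
open import Data.Sum using (_⊎_; inj₁; inj₂; swap; reduce)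
open import Data.Vec.Functional using (updateAt)
open import Data.Vec.Functional.Properties using (updateAt-updates; updateAt-minimal)
open import Function using (_∘_)
open import Relation.Binary.PropositionalEquality
  using (_≡_; _≢_; refl; sym; trans; cong; cong₂; subst; _≗_)
open import Relation.Nullary using (¬_; Dec; yes; no)
open import Relation.Nullary.Decidable using (_⊎-dec_)
open import Relation.Unary using (Decidable)

module _ {A : Set} {P R S : A → Set} (P? : Decidable P) where

  two≤length-filter : ∀ {xs} → (∀ {x} → R x → ¬ S x) →
                      Any (λ x → P x × R x) xs → Any (λ x → P x × S x) xs →
                      2 ≤ length (filter P? xs)
  two≤length-filter R∩S≡∅ (here (_ , r)) (here (_ , s)) = ⊥-elim (R∩S≡∅ r s)
  two≤length-filter {x ∷ _} _ (here (px , _)) (there q) with P? x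
  ... | yes _  = s≤s (filter-some P? (Any.map proj₁ q))
  ... | no ¬px = ⊥-elim (¬px px)
  two≤length-filter {x ∷ _} _ (there p) (here (px , _)) with P? x
  ... | yes _  = s≤s (filter-some P? (Any.map proj₁ p))
  ... | no ¬px = ⊥-elim (¬px px)
  two≤length-filter {x ∷ _} R∩S≡∅ (there p) (there q) with P? x
  ... | yes _ = m≤n⇒m≤1+n (two≤length-filter R∩S≡∅ p q)
  ... | no _  = two≤length-filter R∩S≡∅ p q

allChoices-complete : ∀ n (c : Fin n → Bool) → Any (_≗ c) (allChoices n)
allChoices-complete zero    c = here (λ ())
allChoices-complete (suc n) c with c zero in c₀
... | false = ++⁺ˡ (map⁺ (Any.map (λ x≗c → λ { zero → sym c₀ ; (suc i) → x≗c i })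
                                  (allChoices-complete n (c ∘ suc))))
... | true  = ++⁺ʳ _ (map⁺ (Any.map (λ x≗c → λ { zero → sym c₀ ; (suc i) → x≗c i })
                                    (allChoices-complete n (c ∘ suc))))

Proper-resp : ∀ {n} (G : Graph n) {γ δ : Fin n → ℕ} → γ ≗ δ → Proper G γ → Proper G δ
Proper-resp G γ≗δ = All.map λ { {u , v} γu≢γv δu≡δv →
  γu≢γv (trans (γ≗δ u) (trans δu≡δv (sym (γ≗δ v)))) }

two≤colL : ∀ {n} (G : Graph n) (L : Fin n → ℕ × ℕ) (c₁ c₂ : Fin n → Bool) (i : Fin n) →
           c₁ i ≢ c₂ i → Proper G (colourOf L c₁) → Proper G (colourOf L c₂) → 2 ≤ colL G L
two≤colL {n} G L c₁ c₂ i c₁≢c₂ proper₁ proper₂ =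
  two≤length-filter (λ c → proper? G (colourOf L c)) disjoint (listed proper₁) (listed proper₂)
  where
  listed : ∀ {c} → Proper G (colourOf L c) →
           Any (λ x → Proper G (colourOf L x) × x ≗ c) (allChoices n)
  listed {c} proper = Any.map (λ x≗c → Proper-resp G (λ v → cong (pick (L v)) (sym (x≗c v))) proper , x≗c)
                              (allChoices-complete n c)
  disjoint : ∀ {x} → x ≗ c₁ → ¬ (x ≗ c₂)
  disjoint x≗c₁ x≗c₂ = c₁≢c₂ (trans (sym (x≗c₁ i)) (x≗c₂ i))

all-or-any : ∀ {n} {A B : Fin n → Set} → (∀ i → A i ⊎ B i) → (∀ i → A i) ⊎ ∃ B
all-or-any {zero}  _   = inj₁ λ ()
all-or-any {suc n} A⊎B with A⊎B zero | all-or-any (A⊎B ∘ suc)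
... | inj₂ b | _             = inj₂ (zero , b)
... | inj₁ _ | inj₂ (i , b)  = inj₂ (suc i , b)
... | inj₁ a | inj₁ as       = inj₁ λ { zero → a ; (suc i) → as i }

pairs : Fin 4 → Bool × Bool
pairs zero                   = false , false
pairs (suc zero)             = false , true
pairs (suc (suc zero))       = true  , false
pairs (suc (suc (suc zero))) = true  , true

index : Bool × Bool → Fin 4
index (false , false) = zero
index (false , true)  = suc zero
index (true  , false) = suc (suc zero)
index (true  , true)  = suc (suc (suc zero))

index-pairs : ∀ i → index (pairs i) ≡ i
index-pairs zero                   = refl
index-pairs (suc zero)             = refl
index-pairs (suc (suc zero))       = refl
index-pairs (suc (suc (suc zero))) = refl

pairs-index : ∀ st → pairs (index st) ≡ st
pairs-index (false , false) = refl
pairs-index (false , true)  = refl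
pairs-index (true  , false) = refl
pairs-index (true  , true)  = refl

pairs-injective : ∀ {i j} → pairs i ≡ pairs j → i ≡ j
pairs-injective {i} {j} eq = trans (sym (index-pairs i)) (trans (cong index eq) (index-pairs j))

-- A pair xy stands for the set {proj₁ xy , proj₂ xy}.

_∈₂_ : ℕ → ℕ × ℕ → Set
z ∈₂ xy = proj₁ xy ≡ z ⊎ proj₂ xy ≡ z

_∉₂_ : ℕ → ℕ × ℕ → Set
z ∉₂ xy = ¬ (z ∈₂ xy)

_∈₂?_ : ∀ z xy → Dec (z ∈₂ xy)
z ∈₂? xy = (proj₁ xy ≟ z) ⊎-dec (proj₂ xy ≟ z)

_⊆₂_ : ℕ × ℕ → ℕ × ℕ → Set
pq ⊆₂ xy = proj₁ pq ∈₂ xy × proj₂ pq ∈₂ xy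

Distinct : ℕ × ℕ → Set
Distinct pq = proj₁ pq ≢ proj₂ pq

∈₂-⊆₂ : ∀ {z xy uv} → z ∈₂ xy → xy ⊆₂ uv → z ∈₂ uv
∈₂-⊆₂ (inj₁ refl) (x∈ , _) = x∈
∈₂-⊆₂ (inj₂ refl) (_ , y∈) = y∈

⊆₂-trans : ∀ {pq xy uv} → pq ⊆₂ xy → xy ⊆₂ uv → pq ⊆₂ uv
⊆₂-trans (p∈ , q∈) xy⊆uv = ∈₂-⊆₂ p∈ xy⊆uv , ∈₂-⊆₂ q∈ xy⊆uv

⊆₂-reverse : ∀ {pq xy} → Distinct pq → pq ⊆₂ xy → xy ⊆₂ pq
⊆₂-reverse {_ , _} {_ , _} p≢q (inj₁ refl , inj₁ refl) = ⊥-elim (p≢q refl)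
⊆₂-reverse {_ , _} {_ , _} _   (inj₁ refl , inj₂ refl) = inj₁ refl , inj₂ refl
⊆₂-reverse {_ , _} {_ , _} _   (inj₂ refl , inj₁ refl) = inj₂ refl , inj₁ refl
⊆₂-reverse {_ , _} {_ , _} p≢q (inj₂ refl , inj₂ refl) = ⊥-elim (p≢q refl)

⊆₂-diagonal : ∀ {pq x} → pq ⊆₂ (x , x) → proj₁ pq ≡ proj₂ pq
⊆₂-diagonal (p∈ , q∈) = trans (sym (reduce p∈)) (reduce q∈)

pick-injective : ∀ {pq} → Distinct pq → ∀ s t → pick pq s ≡ pick pq t → s ≡ t
pick-injective {_ , _} _   false false _ = refl
pick-injective {_ , _} p≢q false true  e = ⊥-elim (p≢q e)
pick-injective {_ , _} p≢q true  false e = ⊥-elim (p≢q (sym e))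
pick-injective {_ , _} _   true  true  _ = refl

pick-flip : ∀ {pq} → Distinct pq → ∀ s → pick pq s ≢ pick pq (not s)
pick-flip p≢q s = not-¬ refl ∘ pick-injective p≢q s (not s)

pick-∈₂ : ∀ {pq xy} → pq ⊆₂ xy → ∀ t → pick pq t ∈₂ xy
pick-∈₂ {_ , _} (p∈ , _) false = p∈
pick-∈₂ {_ , _} (_ , q∈) true  = q∈

pick-∉₂-or-⊆₂ : ∀ pq xy → (∃ λ t → pick pq t ∉₂ xy) ⊎ pq ⊆₂ xy
pick-∉₂-or-⊆₂ (p , q) xy with p ∈₂? xy | q ∈₂? xy
... | no p∉  | _      = inj₁ (false , p∉)
... | yes _  | no q∉  = inj₁ (true , q∉)
... | yes p∈ | yes q∈ = inj₂ (p∈ , q∈)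

-- A choice st : Bool × Bool colours the part {0, 1} of K23 with colours st ∈ L(0) × L(1).
module ColouringsOfK23 (L : ListAssignment2 5) where

  Λ : Fin 5 → ℕ × ℕ
  Λ = lists L

  a b : Bool → ℕ
  a = pick (Λ zero)
  b = pick (Λ (suc zero))

  V : Fin 3 → ℕ × ℕ
  V k = Λ (suc (suc k))

  colours : Bool × Bool → ℕ × ℕ
  colours st = a (proj₁ st) , b (proj₂ st)

  opposite : Bool × Bool → Bool × Bool
  opposite st = not (proj₁ st) , not (proj₂ st)

  extend : Bool × Bool → (Fin 3 → Bool) → Fin 5 → Bool
  extend st f zero          = proj₁ st
  extend st f (suc zero)    = proj₂ st
  extend st f (suc (suc k)) = f k

  Extendable Blocked Separated : Bool × Bool → Set
  Extendable st = ∀ k → ∃ λ t → pick (V k) t ∉₂ colours st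
  Blocked    st = ∃ λ k → V k ⊆₂ colours st
  Separated  st = ∀ {z} → z ∈₂ colours (opposite st) → z ∉₂ colours st

  extend-proper : ∀ st f → (∀ k → pick (V k) (f k) ∉₂ colours st) →
                  Proper K23 (colourOf Λ (extend st f))
  extend-proper st f avoids =
    avoids zero ∘ inj₁ ∷ avoids (suc zero) ∘ inj₁ ∷ avoids (suc (suc zero)) ∘ inj₁ ∷
    avoids zero ∘ inj₂ ∷ avoids (suc zero) ∘ inj₂ ∷ avoids (suc (suc zero)) ∘ inj₂ ∷ []

  extendable-or-blocked : ∀ st → Extendable st ⊎ Blocked st
  extendable-or-blocked st = all-or-any (λ k → pick-∉₂-or-⊆₂ (V k) (colours st))

  extension : ∀ {st} → Extendable st → Fin 5 → Bool
  extension {st} ext = extend st (proj₁ ∘ ext)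

  extension-proper : ∀ st (ext : Extendable st) →
                     Proper K23 (colourOf Λ (extension ext))
  extension-proper st ext = extend-proper st (proj₁ ∘ ext) (proj₂ ∘ ext)

  two≤col-of-separated : ∀ st → Extendable st → Separated st → 2 ≤ colL K23 Λ
  two≤col-of-separated st ext sep with extendable-or-blocked (opposite st)
  ... | inj₁ ext′ =
    two≤colL K23 Λ (extension ext) (extension ext′) zero (not-¬ refl)
             (extension-proper st ext) (extension-proper (opposite st) ext′)
  ... | inj₂ (k , Vk⊆) =
    two≤colL K23 Λ (extension ext) (extend st (updateAt f k not)) (suc (suc k)) flip-differs
             (extension-proper st ext)
             (extend-proper st (updateAt f k not) flip-avoids)
    where
    f : Fin 3 → Bool
    f = proj₁ ∘ ext
    flip-differs : f k ≢ updateAt f k not k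
    flip-differs eq = not-¬ refl (trans eq (updateAt-updates k f))
    flip-avoids : ∀ j → pick (V j) (updateAt f k not j) ∉₂ colours st
    flip-avoids j with j Fin.≟ k
    ... | yes refl = sep (pick-∈₂ Vk⊆ (updateAt f k not k))
    ... | no j≢k rewrite updateAt-minimal j k {not} f j≢k = proj₂ (ext j)

  separated : ∀ s t → a (not s) ≢ b t → b (not t) ≢ a s → Separated (s , t)
  separated s t _   _   (inj₁ refl) (inj₁ e) = pick-flip (distinct L zero) s e
  separated _ _ a≢b _   (inj₁ refl) (inj₂ e) = a≢b (sym e)
  separated _ _ _   b≢a (inj₂ refl) (inj₁ e) = b≢a (sym e)
  separated s t _   _   (inj₂ refl) (inj₂ e) = pick-flip (distinct L (suc zero)) t e

  module _ (s t : Bool) (shared : a s ≡ b t) where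

    shared-extendable : Extendable (s , t)
    shared-extendable with extendable-or-blocked (s , t)
    ... | inj₁ ext        = ext
    ... | inj₂ (k , Vk⊆) = ⊥-elim (distinct L (suc (suc k))
                             (⊆₂-diagonal (subst (λ y → V k ⊆₂ (a s , y)) (sym shared) Vk⊆)))

    shared-separated : Separated (s , t)
    shared-separated = separated s t (λ e → pick-flip (distinct L zero) s (sym (trans e (sym shared))))
                                     (λ e → pick-flip (distinct L (suc zero)) t (sym (trans e shared)))

  module _ (apart : ∀ s t → a s ≢ b t) where

    blocked-unique : ∀ {k st st′} → V k ⊆₂ colours st → V k ⊆₂ colours st′ → st ≡ st′
    blocked-unique {k} {s , t} {s′ , t′} Vk⊆ Vk⊆′
      with ⊆₂-trans (⊆₂-reverse (distinct L (suc (suc k))) Vk⊆) Vk⊆′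
    ... | inj₁ a≡ , inj₂ b≡ = sym (cong₂ _,_ (pick-injective (distinct L zero) s′ s a≡)
                                             (pick-injective (distinct L (suc zero)) t′ t b≡))
    ... | inj₂ b≡a , _      = ⊥-elim (apart s t′ (sym b≡a))
    ... | inj₁ _ , inj₁ a≡b = ⊥-elim (apart s′ t a≡b)

    some-extendable : ∃ Extendable
    some-extendable with all-or-any (λ i → swap (extendable-or-blocked (pairs i)))
    ... | inj₂ (i , ext) = pairs i , ext
    ... | inj₁ blocked   with Fin.pigeonhole (n<1+n 3) (proj₁ ∘ blocked)
    ...   | i , j , i<j , same = ⊥-elim (Fin.<⇒≢ i<j (pairs-injective (blocked-unique Vk⊆ Vk⊆′)))
      where
      Vk⊆  = proj₂ (blocked i)
      Vk⊆′ = subst (λ k → V k ⊆₂ colours (pairs j)) (sym same) (proj₂ (blocked j))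

    apart-separated : ∀ st → Separated st
    apart-separated (s , t) = separated s t (apart (not s) t) (apart s (not t) ∘ sym)

  shared-or-apart : (∃ λ st → a (proj₁ st) ≡ b (proj₂ st)) ⊎ (∀ s t → a s ≢ b t)
  shared-or-apart with Fin.any? (λ i → a (proj₁ (pairs i)) ≟ b (proj₂ (pairs i)))
  ... | yes (i , shared) = inj₁ (pairs i , shared)
  ... | no none          = inj₂ λ s t shared → none (index (s , t) ,
          subst (λ st → a (proj₁ st) ≡ b (proj₂ st)) (sym (pairs-index (s , t))) shared)

  two≤col : 2 ≤ col K23 L
  two≤col with shared-or-apart
  ... | inj₁ ((s , t) , shared) =
    two≤col-of-separated (s , t) (shared-extendable s t shared) (shared-separated s t shared)
  ... | inj₂ apart with some-extendable apart
  ...   | st , ext = two≤col-of-separated st ext (apart-separated apart st)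

col2-K23 : col2 K23 ≡ 2
col2-K23 = refl

mainTheorem7 : TwoMonophilic K23
mainTheorem7 L = subst (_≤ col K23 L) (sym col2-K23) (ColouringsOfK23.two≤col L)
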